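{- Let $k,a,b$ be positive integers such that $k=a+b$ and $4<2a\le k$. Then \[\binom{2k}{k}\neq\binom{2a}{a}\binom{a+2b-3}{b}.\] -}

{-# OPTIONS --safe #-}
module Submission where

open import Data.Fin using (Fin; toℕ; fromℕ<)
open import Data.Fin.Properties using (all?; toℕ-fromℕ<)
open import Data.Nat
open import Data.Nat.Combinatorics using (_C_; nCk≡n!/k![n-k]!; k![n∸k]!∣n!)
open import Data.Nat.DivMod using (m/n*n≡m)
open import Data.Nat.Properties
open import Data.Nat.Tactic.RingSolver using (solve-∀)
open import Data.Sum using (inj₁; inj₂)
open import Relation.Binary.PropositionalEquality
open import Relation.Nullary using (yes; no; ¬?)
open import Relation.Nullary.Decidable using (toWitness)

-- Write a = 3 + c and regard both sides as sequences in b: L b = C(2(a+b), a+b) and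
-- R b = C(2a, a) C(c+2b, b), which agree at b = 0. Their successive ratios are 2(2k+1)/(k+1)
-- (with k = a + b) and (c+2b+2)(c+2b+1)/((b+1)(b+c+1)); cross-multiplied, the second exceeds
-- the first by c³ + 3c² − 4c − 6 + b(c − 3)(c + 2). For a ≥ 6 this is positive for every b, so
-- R b > L b for all b ≥ 1; for a = 3, 4 it is negative, so L b > R b. For a = 5 it is negative
-- from b = 2 on, so once L overtakes R (between b = 58 and b = 59) it stays ahead; the values
-- b ≤ 59 are checked by evaluation.

binomial-factorial : ∀ i j → ((i + j) C i) * (i ! * j !) ≡ (i + j) !
binomial-factorial i j = begin
  ((i + j) C i) * (i ! * j !)              ≡⟨ cong (λ m → ((i + j) C i) * (i ! * m !)) (m+n∸m≡n i j) ⟨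
  ((i + j) C i) * d                        ≡⟨ cong (_* d) (nCk≡n!/k![n-k]! i≤i+j) ⟩
  ((i + j) ! / d) {{d≢0}} * d              ≡⟨ m/n*n≡m {{d≢0}} (k![n∸k]!∣n! i≤i+j) ⟩
  (i + j) !                                ∎
  where
  open ≡-Reasoning
  i≤i+j : i ≤ i + j
  i≤i+j = m≤m+n i j
  d : ℕ
  d = i ! * (i + j ∸ i) !
  d≢0 : NonZero d
  d≢0 = i !* (i + j ∸ i) !≢0

binomial-pos : ∀ i j → 0 < (i + j) C i
binomial-pos i j = n≢0⇒n>0 λ C≡0 → ≢-nonZero⁻¹ ((i + j) !) {{(i + j) !≢0}}
  (trans (sym (binomial-factorial i j)) (cong (_* (i ! * j !)) C≡0))

binomial-step : ∀ i j →
  ((suc i + suc j) C suc i) * (suc i * suc j) ≡ ((i + j) C i) * (suc (suc (i + j)) * suc (i + j))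
binomial-step i j = *-cancelʳ-≡ _ _ (i ! * j !) {{i !* j !≢0}} (begin
  B′ * (suc i * suc j) * (i ! * j !)            ≡⟨ regroup B′ (suc i) (suc j) (i !) (j !) ⟩
  B′ * (suc i ! * suc j !)                      ≡⟨ binomial-factorial (suc i) (suc j) ⟩
  suc (i + suc j) !                             ≡⟨ cong (λ n → suc n !) (+-suc i j) ⟩
  suc (suc (i + j)) * (suc (i + j) * (i + j) !)
    ≡⟨ cong (λ x → suc (suc (i + j)) * (suc (i + j) * x)) (binomial-factorial i j) ⟨
  suc (suc (i + j)) * (suc (i + j) * (B * (i ! * j !)))
    ≡⟨ reorder (suc (suc (i + j))) (suc (i + j)) B (i ! * j !) ⟩
  B * (suc (suc (i + j)) * suc (i + j)) * (i ! * j !) ∎)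
  where
  open ≡-Reasoning
  B B′ : ℕ
  B = (i + j) C i
  B′ = (suc i + suc j) C suc i
  regroup : ∀ x p q u v → x * (p * q) * (u * v) ≡ x * ((p * u) * (q * v))
  regroup = solve-∀
  reorder : ∀ s t x y → s * (t * (x * y)) ≡ x * (s * t) * y
  reorder = solve-∀

2*n≡n+n : ∀ n → 2 * n ≡ n + n
2*n≡n+n = solve-∀

central : ℕ → ℕ
central k = (2 * k) C k

central-pos : ∀ k → 0 < central k
central-pos k = subst (λ n → 0 < n C k) (sym (2*n≡n+n k)) (binomial-pos k k)

central-step : ∀ k → central (suc k) * suc k ≡ central k * (2 * suc (2 * k))
central-step k = *-cancelʳ-≡ _ _ (suc k) (begin
  central (suc k) * suc k * suc k
    ≡⟨ *-assoc (central (suc k)) (suc k) (suc k) ⟩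
  central (suc k) * (suc k * suc k)
    ≡⟨ cong (λ n → (n C suc k) * (suc k * suc k)) (2*n≡n+n (suc k)) ⟩
  ((suc k + suc k) C suc k) * (suc k * suc k)
    ≡⟨ binomial-step k k ⟩
  ((k + k) C k) * (suc (suc (k + k)) * suc (k + k))
    ≡⟨ cong (λ n → (n C k) * (suc (suc (k + k)) * suc (k + k))) (2*n≡n+n k) ⟨
  central k * (suc (suc (k + k)) * suc (k + k))
    ≡⟨ cong (central k *_) (factor k) ⟩
  central k * (2 * suc (2 * k) * suc k)
    ≡⟨ *-assoc (central k) (2 * suc (2 * k)) (suc k) ⟨
  central k * (2 * suc (2 * k)) * suc k
    ∎)
  where
  open ≡-Reasoning
  factor : ∀ k → suc (suc (k + k)) * suc (k + k) ≡ 2 * suc (2 * k) * suc k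
  factor = solve-∀

module RatioComparison
    (f g p q r s : ℕ → ℕ)
    (f-step : ∀ n → f (suc n) * p n ≡ f n * q n)
    (g-step : ∀ n → g (suc n) * r n ≡ g n * s n)
  where

  below-step : ∀ {n} → f n ≤ g n → 0 < g n → q n * r n < s n * p n → f (suc n) < g (suc n)
  below-step {n} f≤g 0<g ratio = *-cancelʳ-< (p n * r n) (f (suc n)) (g (suc n)) (begin-strict
    f (suc n) * (p n * r n)  ≡⟨ *-assoc (f (suc n)) (p n) (r n) ⟨
    f (suc n) * p n * r n    ≡⟨ cong (_* r n) (f-step n) ⟩
    f n * q n * r n          ≡⟨ *-assoc (f n) (q n) (r n) ⟩
    f n * (q n * r n)        ≤⟨ *-monoˡ-≤ (q n * r n) f≤g ⟩
    g n * (q n * r n)        <⟨ *-monoʳ-< (g n) {{>-nonZero 0<g}} ratio ⟩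
    g n * (s n * p n)        ≡⟨ *-assoc (g n) (s n) (p n) ⟨
    g n * s n * p n          ≡⟨ cong (_* p n) (g-step n) ⟨
    g (suc n) * r n * p n    ≡⟨ *-assoc (g (suc n)) (r n) (p n) ⟩
    g (suc n) * (r n * p n)  ≡⟨ cong (g (suc n) *_) (*-comm (r n) (p n)) ⟩
    g (suc n) * (p n * r n)  ∎)
    where open ≤-Reasoning

  below-from : ∀ n → (∀ {m} → n ≤ m → q m * r m < s m * p m) →
               f n ≤ g n → 0 < g n → ∀ m → n < m → f m < g m
  below-from n ratio f≤g 0<g (suc m) n<1+m with m≤n⇒m<n∨m≡n (s≤s⁻¹ n<1+m)
  ... | inj₂ refl = below-step f≤g 0<g (ratio ≤-refl)
  ... | inj₁ n<m  = below-step (<⇒≤ f<g) (≤-<-trans z≤n f<g) (ratio (<⇒≤ n<m))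
    where f<g = below-from n ratio f≤g 0<g m n<m

M : ℕ → ℕ → ℕ
M c b = (c + 2 * b) C b

M-num M-den : ℕ → ℕ → ℕ
M-num c b = suc (suc (b + (b + c))) * suc (b + (b + c))
M-den c b = suc b * suc (b + c)

M-step : ∀ c b → M c (suc b) * M-den c b ≡ M c b * M-num c b
M-step c b = begin
  M c (suc b) * M-den c b                      ≡⟨ cong (λ n → (n C suc b) * M-den c b) (shape c (suc b)) ⟩
  ((suc b + suc (b + c)) C suc b) * M-den c b  ≡⟨ binomial-step b (b + c) ⟩
  ((b + (b + c)) C b) * M-num c b              ≡⟨ cong (λ n → (n C b) * M-num c b) (shape c b) ⟨
  M c b * M-num c b                            ∎
  where
  open ≡-Reasoning
  shape : ∀ c b → c + 2 * b ≡ b + (b + c)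
  shape = solve-∀

L R : ℕ → ℕ → ℕ
L c b = central (3 + c + b)
R c b = central (3 + c) * M c b

L-num L-den : ℕ → ℕ → ℕ
L-num c b = 2 * suc (2 * (3 + c + b))
L-den c b = suc (3 + c + b)

L-step : ∀ c b → L c (suc b) * L-den c b ≡ L c b * L-num c b
L-step c b = trans (cong (λ k → central k * L-den c b) (+-suc (3 + c) b)) (central-step (3 + c + b))

R-step : ∀ c b → R c (suc b) * M-den c b ≡ R c b * M-num c b
R-step c b = begin
  central (3 + c) * M c (suc b) * M-den c b    ≡⟨ *-assoc (central (3 + c)) (M c (suc b)) (M-den c b) ⟩
  central (3 + c) * (M c (suc b) * M-den c b)  ≡⟨ cong (central (3 + c) *_) (M-step c b) ⟩
  central (3 + c) * (M c b * M-num c b)        ≡⟨ *-assoc (central (3 + c)) (M c b) (M-num c b) ⟨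
  R c b * M-num c b                            ∎
  where open ≡-Reasoning

L≡R-at-0 : ∀ c → L c 0 ≡ R c 0
L≡R-at-0 c = trans (cong central (+-identityʳ (3 + c))) (sym (*-identityʳ (central (3 + c))))

-- w is explicit: inferring it by unification makes Agda normalise both sides.
<-by-gap : ∀ {x y} w → x + suc w ≡ y → x < y
<-by-gap {x} _ refl = m<m+n x z<s

L-ratio<M-ratio : ∀ d b → L-num (3 + d) b * M-den (3 + d) b < M-num (3 + d) b * L-den (3 + d) b
L-ratio<M-ratio d b = <-by-gap (35 + 41 * d + 12 * d * d + d * d * d + b * d * (5 + d)) (gap d b)
  where
  gap : ∀ d b → 2 * suc (2 * (6 + d + b)) * (suc b * suc (b + (3 + d)))
                  + suc (35 + 41 * d + 12 * d * d + d * d * d + b * d * (5 + d))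
              ≡ suc (suc (b + (b + (3 + d)))) * suc (b + (b + (3 + d))) * suc (6 + d + b)
  gap = solve-∀

M-ratio<L-ratio-a≡3 : ∀ b → M-num 0 b * L-den 0 b < L-num 0 b * M-den 0 b
M-ratio<L-ratio-a≡3 b = <-by-gap (5 + 6 * b) (gap b)
  where
  gap : ∀ b → suc (suc (b + (b + 0))) * suc (b + (b + 0)) * suc (3 + b) + suc (5 + 6 * b)
            ≡ 2 * suc (2 * (3 + b)) * (suc b * suc (b + 0))
  gap = solve-∀

M-ratio<L-ratio-a≡4 : ∀ b → M-num 1 b * L-den 1 b < L-num 1 b * M-den 1 b
M-ratio<L-ratio-a≡4 b = <-by-gap (5 + 6 * b) (gap b)
  where
  gap : ∀ b → suc (suc (b + (b + 1))) * suc (b + (b + 1)) * suc (4 + b) + suc (5 + 6 * b)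
            ≡ 2 * suc (2 * (4 + b)) * (suc b * suc (b + 1))
  gap = solve-∀

M-ratio<L-ratio-a≡5 : ∀ {b} → 2 ≤ b → M-num 2 b * L-den 2 b < L-num 2 b * M-den 2 b
M-ratio<L-ratio-a≡5 {b} 2≤b =
  subst (λ b → M-num 2 b * L-den 2 b < L-num 2 b * M-den 2 b) (m+[n∸m]≡n 2≤b)
    (<-by-gap (1 + 4 * e) (gap e))
  where
  e : ℕ
  e = b ∸ 2
  gap : ∀ e → suc (suc (suc (suc e) + (suc (suc e) + 2))) * suc (suc (suc e) + (suc (suc e) + 2))
                * suc (3 + 2 + suc (suc e)) + suc (1 + 4 * e)
            ≡ 2 * suc (2 * (3 + 2 + suc (suc e))) * (suc (suc (suc e)) * suc (suc (suc e) + 2))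
  gap = solve-∀

module L-below-R (c : ℕ) =
  RatioComparison (L c) (R c) (L-den c) (L-num c) (M-den c) (M-num c) (L-step c) (R-step c)
module R-below-L (c : ℕ) =
  RatioComparison (R c) (L c) (M-den c) (M-num c) (L-den c) (L-num c) (R-step c) (L-step c)

L<R-a≥6 : ∀ d e → L (3 + d) (suc e) < R (3 + d) (suc e)
L<R-a≥6 d e = L-below-R.below-from (3 + d) 0 (λ {b} _ → L-ratio<M-ratio d b)
  (≤-reflexive (L≡R-at-0 (3 + d))) (subst (0 <_) (L≡R-at-0 (3 + d)) (central-pos (3 + (3 + d) + 0)))
  (suc e) z<s

R<L-a≡3 : ∀ e → R 0 (suc e) < L 0 (suc e)
R<L-a≡3 e = R-below-L.below-from 0 0 (λ {b} _ → M-ratio<L-ratio-a≡3 b) ≤-refl (central-pos 3)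
  (suc e) z<s

R<L-a≡4 : ∀ e → R 1 (suc e) < L 1 (suc e)
R<L-a≡4 e = R-below-L.below-from 1 0 (λ {b} _ → M-ratio<L-ratio-a≡4 b) ≤-refl (central-pos 4)
  (suc e) z<s

R<L-a≡5-large : ∀ e → 59 ≤ e → R 2 (suc e) < L 2 (suc e)
R<L-a≡5-large e 59≤e =
  R-below-L.below-from 2 59 ratio (<⇒≤ crossing) (≤-<-trans z≤n crossing) (suc e) (s≤s 59≤e)
  where
  crossing : R 2 59 < L 2 59
  crossing = toWitness {a? = R 2 59 <? L 2 59} _
  ratio : ∀ {b} → 59 ≤ b → M-num 2 b * L-den 2 b < L-num 2 b * M-den 2 b
  ratio 59≤b = M-ratio<L-ratio-a≡5 (≤-trans (s≤s (s≤s z≤n)) 59≤b)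

L≢R-a≡5-small : ∀ e → e < 59 → L 2 (suc e) ≢ R 2 (suc e)
L≢R-a≡5-small e e<59 =
  subst (λ n → L 2 (suc n) ≢ R 2 (suc n)) (toℕ-fromℕ< e<59) (table (fromℕ< e<59))
  where
  table : ∀ (i : Fin 59) → L 2 (suc (toℕ i)) ≢ R 2 (suc (toℕ i))
  table = toWitness {a? = all? λ i → ¬? (L 2 (suc (toℕ i)) ≟ R 2 (suc (toℕ i)))} _

L≢R : ∀ c e → L c (suc e) ≢ R c (suc e)
L≢R 0 e = >⇒≢ (R<L-a≡3 e)
L≢R 1 e = >⇒≢ (R<L-a≡4 e)
L≢R 2 e with e <? 59
... | yes e<59 = L≢R-a≡5-small e e<59
... | no e≮59  = >⇒≢ (R<L-a≡5-large e (≮⇒≥ e≮59))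
L≢R (suc (suc (suc d))) e = <⇒≢ (L<R-a≥6 d e)

lemma2p5 : (k a b : ℕ) → 0 < a → 0 < b → k ≡ a + b → 4 < 2 * a → 2 * a ≤ k →
    (2 * k) C k ≢ ((2 * a) C a) * ((a + 2 * b ∸ 3) C b)
lemma2p5 _ (suc (suc (suc c))) (suc e) _ _ refl _ _ = L≢R c e
lemma2p5 _ 0 _ _ _ _ () _
lemma2p5 _ 1 _ _ _ _ (s≤s (s≤s ())) _
lemma2p5 _ 2 _ _ _ _ (s≤s (s≤s (s≤s (s≤s ())))) _
lemma2p5 _ (suc (suc (suc c))) 0 _ () _ _ _
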